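{- Let $k>1$ and $n>1$ be integers, and define $A_k(n)=(-1)^n\sum_{j=1}^{n-1}(-1)^{j+1}j^k$. Then: if $k$ is even and $n$ is odd, $A_k(n)\equiv 0\pmod{n(n-1)/2}$; if $k$ and $n$ are both even, $A_k(n)\equiv 0\pmod{n-1}$; if $k$ is odd, $A_k(n)\equiv \lfloor n/2\rfloor^2\pmod{2\lfloor n/2\rfloor^2}$.
   Context: $\lfloor r\rfloor$ denotes the greatest integer less than or equal to the real number $r$. -}

module Defs where

open import Data.Nat as ℕ using (ℕ; zero; suc; _∸_)
open import Data.Nat.Divisibility as ℕD using ()
open import Data.Integer as ℤ using (ℤ; +_; -_; _-_)
open import Data.Integer.Divisibility using (_∣_)
open import Relation.Nullary using (¬_)

negOnePow : ℕ → ℤ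
negOnePow zero = + 1
negOnePow (suc m) = - negOnePow m

altSum : ℕ → ℕ → ℤ
altSum k zero = + 0
altSum k (suc j) = altSum k j ℤ.+ negOnePow (suc (suc j)) ℤ.* (+ (suc j ℕ.^ k))

A : ℕ → ℕ → ℤ
A k n = negOnePow n ℤ.* altSum k (n ∸ 1)

Even : ℕ → Set
Even m = 2 ℕD.∣ m

Odd : ℕ → Set
Odd m = ¬ Even m

_≡_[modℤ_] : ℤ → ℤ → ℕ → Set
a ≡ b [modℤ m ] = (+ m) ∣ (a - b)

module Submission where

-- Every step compares a summand with its image under an index shift or a reflection,
-- modulo a suitable number.  Three congruences carry the proof:
--  * odd modulus:    for d odd and k > 0 even, d ∣ S k d, because j ↦ d - j negates
--                    (-1)^j j^k modulo d and 2 is invertible modulo d;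
--  * half modulus:   for k > 0 even, S k (2m) ≡ m (mod 2m), by strong induction on m,
--                    pairing the summands i and m + i;
--  * square modulus: for k ≥ 3 odd, S k (2m) ≡ m² (mod 2m²), by reflecting j ↦ 2m - j and
--                    expanding to first order modulo (2m)², which brings in S (k - 1) (2m).  The
-- hypothesis 1 < n of lemma2 turns out not to be needed.

open import Defs

module AlternatingSums where

  open import Data.Empty using (⊥-elim)
  open import Data.Nat as ℕ using (ℕ; zero; suc; _∸_; _≤_; _<_; s≤s)
  import Data.Nat.Properties as ℕ
  import Data.Nat.Divisibility as ℕ∣
  open import Data.Nat.DivMod using (_/_; m*n/n≡m; +-distrib-/-∣ʳ; *-/-assoc)
  open import Data.Nat.Induction using (<-rec)
  open import Data.Integer using (ℤ; +_; -_; _+_; _*_; _-_; _^_; 0ℤ; 1ℤ; NonZero)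
  open import Data.Integer.Properties
  import Data.Integer.Divisibility.Signed as Signed
  open import Data.Integer.Tactic.RingSolver using (solve-∀)
  open import Level using (0ℓ)
  open import Relation.Binary.Bundles using (Setoid)
  import Relation.Binary.Reasoning.Setoid as SetoidReasoning
  open import Relation.Binary.PropositionalEquality

  infix 4 _≡_[mod_]
  record _≡_[mod_] (a b M : ℤ) : Set where
    constructor mod-by
    field
      quotient : ℤ
      equation : a ≡ b + quotient * M

  module _ {M : ℤ} where

    ≡⇒mod : ∀ {a b} → a ≡ b → a ≡ b [mod M ]
    ≡⇒mod {b = b} refl = mod-by 0ℤ (lemma b M)
      where
      lemma : ∀ b M → b ≡ b + 0ℤ * M
      lemma = solve-∀

    mod-refl : ∀ {a} → a ≡ a [mod M ]
    mod-refl = ≡⇒mod refl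

    mod-sym : ∀ {a b} → a ≡ b [mod M ] → b ≡ a [mod M ]
    mod-sym {b = b} (mod-by q refl) = mod-by (- q) (lemma b q M)
      where
      lemma : ∀ b q M → b ≡ b + q * M + - q * M
      lemma = solve-∀

    mod-trans : ∀ {a b c} → a ≡ b [mod M ] → b ≡ c [mod M ] → a ≡ c [mod M ]
    mod-trans {c = c} (mod-by q refl) (mod-by r refl) = mod-by (r + q) (lemma c r q M)
      where
      lemma : ∀ c r q M → c + r * M + q * M ≡ c + (r + q) * M
      lemma = solve-∀

    mod-+ : ∀ {a b c d} → a ≡ b [mod M ] → c ≡ d [mod M ] → a + c ≡ b + d [mod M ]
    mod-+ {b = b} {d = d} (mod-by q refl) (mod-by r refl) = mod-by (q + r) (lemma b d q r M)
      where
      lemma : ∀ b d q r M → b + q * M + (d + r * M) ≡ b + d + (q + r) * M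
      lemma = solve-∀

    mod-neg : ∀ {a b} → a ≡ b [mod M ] → - a ≡ - b [mod M ]
    mod-neg {b = b} (mod-by q refl) = mod-by (- q) (lemma b q M)
      where
      lemma : ∀ b q M → - (b + q * M) ≡ - b + - q * M
      lemma = solve-∀

    mod-* : ∀ {a b c d} → a ≡ b [mod M ] → c ≡ d [mod M ] → a * c ≡ b * d [mod M ]
    mod-* {b = b} {d = d} (mod-by q refl) (mod-by r refl) =
      mod-by (q * d + b * r + q * r * M) (lemma b d q r M)
      where
      lemma : ∀ b d q r M → (b + q * M) * (d + r * M) ≡ b * d + (q * d + b * r + q * r * M) * M
      lemma = solve-∀

    mod-^ : ∀ {a b} e → a ≡ b [mod M ] → a ^ e ≡ b ^ e [mod M ]
    mod-^ zero    a≡b = mod-refl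
    mod-^ (suc e) a≡b = mod-* a≡b (mod-^ e a≡b)

    mod-*-zero : ∀ {a} c → a ≡ 0ℤ [mod M ] → c * a ≡ 0ℤ [mod M ]
    mod-*-zero c a≡0 = mod-trans (mod-* (mod-refl {a = c}) a≡0) (≡⇒mod (*-zeroʳ c))

    multiple≡0 : ∀ q → q * M ≡ 0ℤ [mod M ]
    multiple≡0 q = mod-by q (sym (+-identityˡ (q * M)))

    mod-weaken : ∀ {a b} c → a ≡ b [mod c * M ] → a ≡ b [mod M ]
    mod-weaken {b = b} c (mod-by q refl) = mod-by (q * c) (lemma b q c M)
      where
      lemma : ∀ b q c M → b + q * (c * M) ≡ b + q * c * M
      lemma = solve-∀

    mod-scale : ∀ {a b} c → a ≡ b [mod M ] → c * a ≡ c * b [mod c * M ]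
    mod-scale {b = b} c (mod-by q refl) = mod-by q (lemma c b q M)
      where
      lemma : ∀ c b q M → c * (b + q * M) ≡ c * b + q * (c * M)
      lemma = solve-∀

    mod-cancel : ∀ {a b} c .{{_ : NonZero c}} → c * a ≡ c * b [mod c * M ] → a ≡ b [mod M ]
    mod-cancel {a} {b} c (mod-by q eq) =
      mod-by q (*-cancelˡ-≡ c a (b + q * M) (trans eq (lemma c b q M)))
      where
      lemma : ∀ c b q M → c * b + q * (c * M) ≡ c * (b + q * M)
      lemma = solve-∀

    mod-cancel-unit : ∀ {a b} u v c → u * c + v * M ≡ 1ℤ →
                      c * a ≡ c * b [mod M ] → a ≡ b [mod M ]
    mod-cancel-unit {a} {b} u v c bezout (mod-by q eq) =
      mod-by (u * q + v * (a - b)) (begin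
        a                                                ≡⟨ lemma₁ a b ⟩
        b + (a - b) * 1ℤ                                 ≡⟨ cong (λ z → b + (a - b) * z) bezout ⟨
        b + (a - b) * (u * c + v * M)                    ≡⟨ lemma₂ a b u v c M ⟩
        b + u * (c * a - c * b) + v * (a - b) * M
          ≡⟨ cong (λ z → b + u * (z - c * b) + v * (a - b) * M) eq ⟩
        b + u * (c * b + q * M - c * b) + v * (a - b) * M ≡⟨ lemma₃ a b u v c q M ⟩
        b + (u * q + v * (a - b)) * M                    ∎)
      where
      open ≡-Reasoning
      lemma₁ : ∀ a b → a ≡ b + (a - b) * 1ℤ
      lemma₁ = solve-∀
      lemma₂ : ∀ a b u v c M →
               b + (a - b) * (u * c + v * M) ≡ b + u * (c * a - c * b) + v * (a - b) * M
      lemma₂ = solve-∀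
      lemma₃ : ∀ a b u v c q M →
               b + u * (c * b + q * M - c * b) + v * (a - b) * M ≡ b + (u * q + v * (a - b)) * M
      lemma₃ = solve-∀

  mod-modulus : ∀ {a b M N} → M ≡ N → a ≡ b [mod M ] → a ≡ b [mod N ]
  mod-modulus refl a≡b = a≡b

  mod-crt : ∀ {x a M N} u v → u * M + v * N ≡ 1ℤ →
            x ≡ a [mod M ] → x ≡ a [mod N ] → x ≡ a [mod M * N ]
  mod-crt {x} {a} {M} {N} u v bezout (mod-by p eqM) (mod-by q eqN) =
    mod-by (q * u + p * v) (begin
      x                                     ≡⟨ lemma₁ x a ⟩
      a + (x - a) * 1ℤ                      ≡⟨ cong (λ z → a + (x - a) * z) bezout ⟨
      a + (x - a) * (u * M + v * N)         ≡⟨ lemma₂ x a u v M N ⟩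
      a + (x - a) * M * u + (x - a) * N * v
        ≡⟨ cong₂ (λ y z → a + y * M * u + z * N * v) (difference q N eqN) (difference p M eqM) ⟩
      a + q * N * M * u + p * M * N * v     ≡⟨ lemma₃ a p q u v M N ⟩
      a + (q * u + p * v) * (M * N)         ∎)
    where
    open ≡-Reasoning
    difference : ∀ r K → x ≡ a + r * K → x - a ≡ r * K
    difference r K refl = lemma a r K
      where
      lemma : ∀ a r K → a + r * K - a ≡ r * K
      lemma = solve-∀
    lemma₁ : ∀ x a → x ≡ a + (x - a) * 1ℤ
    lemma₁ = solve-∀
    lemma₂ : ∀ x a u v M N →
             a + (x - a) * (u * M + v * N) ≡ a + (x - a) * M * u + (x - a) * N * v
    lemma₂ = solve-∀
    lemma₃ : ∀ a p q u v M N →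
             a + q * N * M * u + p * M * N * v ≡ a + (q * u + p * v) * (M * N)
    lemma₃ = solve-∀

  mod⇒modℤ : ∀ {a b m} → a ≡ b [mod + m ] → a ≡ b [modℤ m ]
  mod⇒modℤ {a} {b} {m} (mod-by q eq) =
    Signed.∣⇒∣ᵤ (Signed.divides q (trans (cong (_- b) eq) (lemma b q (+ m))))
    where
    lemma : ∀ b q M → b + q * M - b ≡ q * M
    lemma = solve-∀

  mod-setoid : ℤ → Setoid 0ℓ 0ℓ
  mod-setoid M = record
    { Carrier       = ℤ
    ; _≈_           = λ a b → a ≡ b [mod M ]
    ; isEquivalence = record { refl = mod-refl ; sym = mod-sym ; trans = mod-trans }
    }

  module ModReasoning (M : ℤ) = SetoidReasoning (mod-setoid M)

  Σ< : (ℕ → ℤ) → ℕ → ℤ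
  Σ< f zero    = 0ℤ
  Σ< f (suc N) = Σ< f N + f N

  Σ<-split : ∀ f a b → Σ< f (a ℕ.+ b) ≡ Σ< f a + Σ< (λ i → f (a ℕ.+ i)) b
  Σ<-split f a zero    rewrite ℕ.+-identityʳ a = sym (+-identityʳ (Σ< f a))
  Σ<-split f a (suc b) rewrite ℕ.+-suc a b | Σ<-split f a b = +-assoc (Σ< f a) _ _

  Σ<-head : ∀ f N → Σ< f (suc N) ≡ f 0 + Σ< (λ i → f (suc i)) N
  Σ<-head f N = trans (Σ<-split f 1 N) (cong (_+ Σ< (λ i → f (suc i)) N) (+-identityˡ (f 0)))

  Σ<-reverse : ∀ f N → Σ< f N ≡ Σ< (λ j → f (N ∸ suc j)) N
  Σ<-reverse f zero    = refl
  Σ<-reverse f (suc N) = begin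
    Σ< f N + f N                             ≡⟨ cong (_+ f N) (Σ<-reverse f N) ⟩
    Σ< (λ j → f (N ∸ suc j)) N + f N         ≡⟨ +-comm _ (f N) ⟩
    f N + Σ< (λ j → f (N ∸ suc j)) N         ≡⟨ Σ<-head (λ j → f (suc N ∸ suc j)) N ⟨
    Σ< (λ j → f (suc N ∸ suc j)) (suc N)     ∎
    where open ≡-Reasoning

  Σ<-mod : ∀ {M} f g N → (∀ j → j < N → f j ≡ g j [mod M ]) → Σ< f N ≡ Σ< g N [mod M ]
  Σ<-mod f g zero    f≡g = mod-refl
  Σ<-mod f g (suc N) f≡g =
    mod-+ (Σ<-mod f g N (λ j j<N → f≡g j (ℕ.m<n⇒m<1+n j<N))) (f≡g N ℕ.≤-refl)

  Σ<-+ : ∀ f g N → Σ< (λ j → f j + g j) N ≡ Σ< f N + Σ< g N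
  Σ<-+ f g zero    = refl
  Σ<-+ f g (suc N) rewrite Σ<-+ f g N = lemma (Σ< f N) (Σ< g N) (f N) (g N)
    where
    lemma : ∀ a b c d → a + b + (c + d) ≡ a + c + (b + d)
    lemma = solve-∀

  Σ<-*ˡ : ∀ c f N → Σ< (λ j → c * f j) N ≡ c * Σ< f N
  Σ<-*ˡ c f zero    = sym (*-zeroʳ c)
  Σ<-*ˡ c f (suc N) rewrite Σ<-*ˡ c f N = sym (*-distribˡ-+ c (Σ< f N) (f N))

  Σ<-neg : ∀ f N → Σ< (λ j → - f j) N ≡ - Σ< f N
  Σ<-neg f zero    = refl
  Σ<-neg f (suc N) rewrite Σ<-neg f N = sym (neg-distrib-+ (Σ< f N) (f N))

  Σ<-reflect : ∀ {M} f g N → (∀ j → j ≤ N → f (N ∸ j) ≡ g j [mod M ]) →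
               Σ< f (suc N) ≡ Σ< g (suc N) [mod M ]
  Σ<-reflect f g N f≡g =
    mod-trans (≡⇒mod (Σ<-reverse f (suc N)))
              (Σ<-mod _ g (suc N) (λ j j≤N → f≡g j (ℕ.≤-pred j≤N)))

  σ : ℕ → ℤ
  σ = negOnePow

  σ-+ : ∀ a b → σ (a ℕ.+ b) ≡ σ a * σ b
  σ-+ zero    b = sym (*-identityˡ (σ b))
  σ-+ (suc a) b rewrite σ-+ a b = neg-distribˡ-* (σ a) (σ b)

  σ-squared : ∀ a → σ a * σ a ≡ 1ℤ
  σ-squared zero    = refl
  σ-squared (suc a) = trans (lemma (σ a)) (σ-squared a)
    where
    lemma : ∀ x → - x * - x ≡ x * x
    lemma = solve-∀

  σ-2+ : ∀ a → σ (suc (suc a)) ≡ σ a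
  σ-2+ a = neg-involutive (σ a)

  σ-even : ∀ r → σ (r ℕ.+ r) ≡ 1ℤ
  σ-even r = trans (σ-+ r r) (σ-squared r)

  σ-odd : ∀ r → σ (suc (r ℕ.+ r)) ≡ - 1ℤ
  σ-odd r = cong -_ (σ-even r)

  σ-∸ : ∀ {N j} → j ≤ N → σ (N ∸ j) ≡ σ N * σ j
  σ-∸ {N} {j} j≤N = begin
    σ (N ∸ j)                    ≡⟨ cancel (σ (N ∸ j)) (σ j) (σ-squared j) ⟨
    σ (N ∸ j) * σ j * σ j        ≡⟨ cong (_* σ j) (σ-+ (N ∸ j) j) ⟨
    σ ((N ∸ j) ℕ.+ j) * σ j      ≡⟨ cong (λ x → σ x * σ j) (ℕ.m∸n+n≡m j≤N) ⟩
    σ N * σ j                    ∎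
    where
    open ≡-Reasoning
    cancel : ∀ x y → y * y ≡ 1ℤ → x * y * y ≡ x
    cancel x y y²≡1 = trans (*-assoc x y y) (trans (cong (x *_) y²≡1) (*-identityʳ x))

  Σ<σ-even : ∀ r → Σ< σ (r ℕ.+ r) ≡ 0ℤ
  Σ<σ-even zero    = refl
  Σ<σ-even (suc r) rewrite ℕ.+-suc r r | Σ<σ-even r | σ-even r = refl

  Σ<σ-odd : ∀ r → Σ< σ (suc (r ℕ.+ r)) ≡ 1ℤ
  Σ<σ-odd r rewrite Σ<σ-even r | σ-even r = refl

  pos-^ : ∀ a k → + (a ℕ.^ k) ≡ (+ a) ^ k
  pos-^ a zero    = refl
  pos-^ a (suc k) = trans (pos-* a (a ℕ.^ k)) (cong (+ a *_) (pos-^ a k))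

  pos-∸ : ∀ {d j} → j ≤ d → + (d ∸ j) ≡ + d - + j
  pos-∸ {d} {j} j≤d = sym (trans (m-n≡m⊖n d j) (⊖-≥ j≤d))

  pos-double : ∀ m → + (m ℕ.+ m) ≡ + 2 * + m
  pos-double m = trans (pos-+ m m) (lemma (+ m))
    where
    lemma : ∀ x → x + x ≡ + 2 * x
    lemma = solve-∀

  pos-odd : ∀ r → + suc (r ℕ.+ r) ≡ 1ℤ + + 2 * + r
  pos-odd r = trans (pos-+ 1 (r ℕ.+ r)) (cong (λ x → 1ℤ + x) (pos-double r))

  pos-twice-square : ∀ m → + (2 ℕ.* (m ℕ.* m)) ≡ + 2 * (+ m * + m)
  pos-twice-square m = trans (pos-* 2 (m ℕ.* m)) (cong (+ 2 *_) (pos-* m m))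

  odd-bezout : ∀ r → - + r * + 2 + 1ℤ * + suc (r ℕ.+ r) ≡ 1ℤ
  odd-bezout r = trans (cong (λ d → - + r * + 2 + 1ℤ * d) (pos-odd r)) (lemma (+ r))
    where
    lemma : ∀ r → - r * + 2 + 1ℤ * (1ℤ + + 2 * r) ≡ 1ℤ
    lemma = solve-∀

  binomial : ∀ a b e → (a + b) ^ suc e ≡ a ^ suc e + (+ suc e) * b * a ^ e [mod b * b ]
  binomial a b zero = ≡⇒mod (lemma a b)
    where
    lemma : ∀ a b → (a + b) * 1ℤ ≡ a * 1ℤ + + 1 * b * 1ℤ
    lemma = solve-∀
  binomial a b (suc e) with binomial a b e
  ... | mod-by q eq = mod-by (q * a + c * a ^ e + q * b) (begin
    (a + b) * (a + b) ^ suc e                                 ≡⟨ cong ((a + b) *_) eq ⟩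
    (a + b) * (a ^ suc e + c * b * a ^ e + q * (b * b))       ≡⟨ lemma a b c q (a ^ e) ⟩
    a ^ suc (suc e) + (1ℤ + c) * b * a ^ suc e + rest
      ≡⟨ cong (λ c' → a ^ suc (suc e) + c' * b * a ^ suc e + rest) (pos-+ 1 (suc e)) ⟨
    a ^ suc (suc e) + (+ suc (suc e)) * b * a ^ suc e + rest  ∎)
    where
    open ≡-Reasoning
    c = + suc e
    rest = (q * a + c * a ^ e + q * b) * (b * b)
    lemma : ∀ a b c q x → (a + b) * (a * x + c * b * x + q * (b * b)) ≡
            a * (a * x) + (1ℤ + c) * b * (a * x) + (q * a + c * x + q * b) * (b * b)
    lemma = solve-∀

  neg-^-even : ∀ x t → (- x) ^ (t ℕ.+ t) ≡ x ^ (t ℕ.+ t)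
  neg-^-even x zero    = refl
  neg-^-even x (suc t) rewrite ℕ.+-suc t t | neg-^-even x t = lemma x (x ^ (t ℕ.+ t))
    where
    lemma : ∀ x y → - x * (- x * y) ≡ x * (x * y)
    lemma = solve-∀

  neg-^-odd : ∀ x t → (- x) ^ suc (t ℕ.+ t) ≡ - x ^ suc (t ℕ.+ t)
  neg-^-odd x t rewrite neg-^-even x t = sym (neg-distribˡ-* x _)

  square-mod-2 : ∀ j → (+ j) * (+ j) ≡ + j [mod + 2 ]
  square-mod-2 zero    = mod-refl
  square-mod-2 (suc j) with square-mod-2 j
  ... | mod-by q eq = mod-by (+ j + q) (begin
    + suc j * + suc j                 ≡⟨ cong (λ x → x * x) (pos-+ 1 j) ⟩
    (1ℤ + + j) * (1ℤ + + j)           ≡⟨ lemma₁ (+ j) ⟩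
    1ℤ + + j + + j + + j * + j        ≡⟨ cong (λ x → 1ℤ + + j + + j + x) eq ⟩
    1ℤ + + j + + j + (+ j + q * + 2)  ≡⟨ lemma₂ (+ j) q ⟩
    1ℤ + + j + (+ j + q) * + 2        ≡⟨ cong (λ x → x + (+ j + q) * + 2) (pos-+ 1 j) ⟨
    + suc j + (+ j + q) * + 2         ∎)
    where
    open ≡-Reasoning
    lemma₁ : ∀ x → (1ℤ + x) * (1ℤ + x) ≡ 1ℤ + x + x + x * x
    lemma₁ = solve-∀
    lemma₂ : ∀ x q → 1ℤ + x + x + (x + q * + 2) ≡ 1ℤ + x + (x + q) * + 2
    lemma₂ = solve-∀

  power-mod-2 : ∀ j e → (+ j) ^ suc e ≡ + j [mod + 2 ]
  power-mod-2 j zero    = ≡⇒mod (*-identityʳ (+ j))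
  power-mod-2 j (suc e) = mod-trans (mod-* (mod-refl {a = + j}) (power-mod-2 j e)) (square-mod-2 j)

  term : ℕ → ℕ → ℤ
  term k i = σ (suc (suc i)) * (+ suc i) ^ k

  altSum-Σ< : ∀ k N → altSum k N ≡ Σ< (term k) N
  altSum-Σ< k zero    = refl
  altSum-Σ< k (suc N) = cong₂ _+_ (altSum-Σ< k N) (cong (σ (suc (suc N)) *_) (pos-^ (suc N) k))

  -- The signed powers (-1)^j j^k.  For k ≥ 1 their sum over 0 ≤ j ≤ N is -altSum k N;
  -- unlike altSum this range is symmetric under the reflection j ↦ N - j.
  signedPower : ℕ → ℕ → ℤ
  signedPower k j = σ j * (+ j) ^ k

  Σ<-signedPower : ∀ k N → Σ< (signedPower (suc k)) (suc N) ≡ - altSum (suc k) N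
  Σ<-signedPower k zero    = refl
  Σ<-signedPower k (suc N) = begin
    Σ< (signedPower (suc k)) (suc N) + s * x ^ suc k  ≡⟨ cong (_+ s * x ^ suc k) (Σ<-signedPower k N) ⟩
    - altSum (suc k) N + s * x ^ suc k                ≡⟨ lemma (altSum (suc k) N) s (x ^ suc k) ⟩
    - (altSum (suc k) N + - s * x ^ suc k)
      ≡⟨ cong (λ y → - (altSum (suc k) N + - s * y)) (pos-^ (suc N) (suc k)) ⟨
    - altSum (suc k) (suc N)                          ∎
    where
    open ≡-Reasoning
    s = σ (suc N)
    x = + suc N
    lemma : ∀ a s y → - a + s * y ≡ - (a + - s * y)
    lemma = solve-∀

  altSum≡-Σ< : ∀ k N → altSum (suc k) N ≡ - Σ< (signedPower (suc k)) (suc N)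
  altSum≡-Σ< k N = trans (sym (neg-involutive _)) (cong -_ (sym (Σ<-signedPower k N)))

  altSum-init : ∀ {M} k j → + (suc j ℕ.^ k) ≡ 0ℤ [mod M ] → altSum k j ≡ altSum k (suc j) [mod M ]
  altSum-init k j last≡0 = mod-sym (mod-trans
    (mod-+ (mod-refl {a = altSum k j}) (mod-*-zero (σ (suc (suc j))) last≡0))
    (≡⇒mod (+-identityʳ (altSum k j))))

  -- Odd modulus: for odd d and positive even k, d ∣ altSum k d.  Reflecting j ↦ d - j
  -- negates (-1)^j j^k modulo d, so X = Σ_{j≤d} (-1)^j j^k satisfies X ≡ -X, and 2 is
  -- invertible modulo d.
  altSum-odd-modulus : ∀ t r → altSum (suc t ℕ.+ suc t) (suc (r ℕ.+ r)) ≡ 0ℤ [mod + suc (r ℕ.+ r) ]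
  altSum-odd-modulus t r = mod-trans (≡⇒mod (altSum≡-Σ< (t ℕ.+ suc t) d)) (mod-neg X≡0)
    where
    d = suc (r ℕ.+ r)
    k = suc t ℕ.+ suc t
    X = Σ< (signedPower k) (suc d)

    reflected : ∀ j → j ≤ d → signedPower k (d ∸ j) ≡ - signedPower k j [mod + d ]
    reflected j j≤d = begin
      σ (d ∸ j) * (+ (d ∸ j)) ^ k    ≡⟨ cong₂ _*_ sign (cong (_^ k) (pos-∸ j≤d)) ⟩
      - σ j * (+ d - + j) ^ k        ≈⟨ mod-* (mod-refl {a = - σ j}) (mod-^ k d-j≡-j) ⟩
      - σ j * (- + j) ^ k            ≡⟨ cong (- σ j *_) (neg-^-even (+ j) (suc t)) ⟩
      - σ j * (+ j) ^ k              ≡⟨ neg-distribˡ-* (σ j) _ ⟨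
      - signedPower k j              ∎
      where
      open ModReasoning (+ d)
      sign : σ (d ∸ j) ≡ - σ j
      sign = trans (σ-∸ j≤d) (trans (cong (_* σ j) (σ-odd r)) (-1*i≡-i (σ j)))
      d-j≡-j : + d - + j ≡ - + j [mod + d ]
      d-j≡-j = mod-by 1ℤ (lemma (+ d) (+ j))
        where
        lemma : ∀ d j → d - j ≡ - j + 1ℤ * d
        lemma = solve-∀

    X≡-X : X ≡ - X [mod + d ]
    X≡-X = mod-trans (Σ<-reflect (signedPower k) _ d reflected)
                     (≡⇒mod (Σ<-neg (signedPower k) (suc d)))

    X≡0 : X ≡ 0ℤ [mod + d ]
    X≡0 = mod-cancel-unit (- + r) 1ℤ (+ 2) (odd-bezout r) (begin
      + 2 * X      ≡⟨ lemma X ⟩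
      X + X        ≈⟨ mod-+ X≡-X (mod-refl {a = X}) ⟩
      - X + X      ≡⟨ +-inverseˡ X ⟩
      0ℤ           ≡⟨ *-zeroʳ (+ 2) ⟨
      + 2 * 0ℤ     ∎)
      where
      open ModReasoning (+ d)
      lemma : ∀ x → + 2 * x ≡ x + x
      lemma = solve-∀

  data EvenOdd : ℕ → Set where
    even : ∀ r → EvenOdd (r ℕ.+ r)
    odd  : ∀ r → EvenOdd (suc (r ℕ.+ r))

  even-or-odd : ∀ n → EvenOdd n
  even-or-odd zero = even zero
  even-or-odd (suc n) with even-or-odd n
  ... | even r = odd r
  ... | odd r  = subst EvenOdd (ℕ.+-suc (suc r) r) (even (suc r))

  even-double : ∀ r → Even (r ℕ.+ r)
  even-double r = ℕ∣.divides r (trans (cong (r ℕ.+_) (sym (ℕ.+-identityʳ r))) (ℕ.*-comm 2 r))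

  odd-not-even : ∀ r → Odd (suc (r ℕ.+ r))
  odd-not-even r 2∣odd with ℕ∣.∣1⇒≡1 (ℕ∣.∣m+n∣m⇒∣n 2∣r+r+1 (even-double r))
    where
    2∣r+r+1 : 2 ℕ∣.∣ (r ℕ.+ r) ℕ.+ 1
    2∣r+r+1 = subst (2 ℕ∣.∣_) (ℕ.+-comm 1 (r ℕ.+ r)) 2∣odd
  ... | ()

  half-even : ∀ m → (m ℕ.+ m) / 2 ≡ m
  half-even m = trans (cong (_/ 2) (ℕ∣._∣_.equality (even-double m))) (m*n/n≡m m 2)

  half-odd : ∀ m → suc (m ℕ.+ m) / 2 ≡ m
  half-odd m = trans (+-distrib-/-∣ʳ 1 (even-double m)) (half-even m)

  triangular-odd : ∀ m → (suc (m ℕ.+ m) ℕ.* (m ℕ.+ m)) / 2 ≡ suc (m ℕ.+ m) ℕ.* m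
  triangular-odd m =
    trans (*-/-assoc (suc (m ℕ.+ m)) (even-double m)) (cong (suc (m ℕ.+ m) ℕ.*_) (half-even m))

  -- In
  -- T(m) = altSum e (2m) = Σ_{i<2m} term e i the summands i and m + i are compared:
  --  * for odd m their signs are opposite and their sum is ≡ m (-1)^i modulo 2m,
  --    so T(m) ≡ m Σ_{i<m} (-1)^i = m;
  --  * for m = 2r they agree modulo 2m, so T(m) ≡ 2 T(r) ≡ 2r = m modulo 2m by induction.
  module HalfModulus (t : ℕ) where

    e = suc t ℕ.+ suc t

    HalfCongruence : ℕ → Set
    HalfCongruence m = Σ< (term e) (m ℕ.+ m) ≡ + m [mod + (m ℕ.+ m) ]

    Σ<-halves : ∀ m → Σ< (term e) (m ℕ.+ m) ≡ Σ< (term e) m + Σ< (λ i → term e (m ℕ.+ i)) m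
    Σ<-halves m = Σ<-split (term e) m m

    shifted-base : ∀ m i → + suc (m ℕ.+ i) ≡ + suc i + + m
    shifted-base m i = trans (cong (λ z → + suc z) (ℕ.+-comm m i)) (pos-+ (suc i) m)

    -- For odd M, a^e - (a + M)^e ≡ M modulo 2M: it is ≡ 0 ≡ M modulo M and ≡ M modulo 2.
    power-difference : ∀ r i → let M = + suc (r ℕ.+ r); a = + suc i in
                       a ^ e - (a + M) ^ e ≡ M [mod + 2 * M ]
    power-difference r i = mod-crt (- + r) 1ℤ (odd-bezout r) mod-2 mod-M
      where
      m = suc (r ℕ.+ r)
      M = + m
      a = + suc i
      mod-M : a ^ e - (a + M) ^ e ≡ M [mod M ]
      mod-M = begin
        a ^ e - (a + M) ^ e   ≈⟨ mod-+ (mod-refl {a = a ^ e}) (mod-neg (mod-^ e a+M≡a)) ⟩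
        a ^ e - a ^ e         ≡⟨ +-inverseʳ (a ^ e) ⟩
        0ℤ                    ≈⟨ multiple≡0 1ℤ ⟨
        1ℤ * M                ≡⟨ *-identityˡ M ⟩
        M                     ∎
        where
        open ModReasoning M
        a+M≡a : a + M ≡ a [mod M ]
        a+M≡a = mod-by 1ℤ (cong (λ x → a + x) (sym (*-identityˡ M)))
      mod-2 : a ^ e - (a + M) ^ e ≡ M [mod + 2 ]
      mod-2 = begin
        a ^ e - (a + M) ^ e            ≡⟨ cong (λ x → a ^ e - x ^ e) (pos-+ (suc i) m) ⟨
        a ^ e - (+ (suc i ℕ.+ m)) ^ e
          ≈⟨ mod-+ (power-mod-2 (suc i) (t ℕ.+ suc t)) (mod-neg (power-mod-2 (suc i ℕ.+ m) (t ℕ.+ suc t))) ⟩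
        a - + (suc i ℕ.+ m)            ≡⟨ cong (λ x → a - x) (pos-+ (suc i) m) ⟩
        a - (a + M)                    ≡⟨ lemma a M ⟩
        M + - M * + 2                  ≈⟨ mod-+ (mod-refl {a = M}) (multiple≡0 (- M)) ⟩
        M + 0ℤ                         ≡⟨ +-identityʳ M ⟩
        M                              ∎
        where
        open ModReasoning (+ 2)
        lemma : ∀ a M → a - (a + M) ≡ M + - M * + 2
        lemma = solve-∀

    odd-pair : ∀ r i → let m = suc (r ℕ.+ r) in
               term e i + term e (m ℕ.+ i) ≡ + m * σ i [mod + (m ℕ.+ m) ]
    odd-pair r i = mod-modulus (sym (pos-double m)) (begin
      term e i + term e (m ℕ.+ i)
        ≡⟨ cong₂ _+_ (cong (_* a ^ e) (σ-2+ i)) (cong₂ _*_ sign (cong (_^ e) (shifted-base m i))) ⟩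
      σ i * a ^ e + - 1ℤ * σ i * (a + M) ^ e     ≡⟨ lemma (σ i) (a ^ e) ((a + M) ^ e) ⟩
      σ i * (a ^ e - (a + M) ^ e)                ≈⟨ mod-* (mod-refl {a = σ i}) (power-difference r i) ⟩
      σ i * M                                    ≡⟨ *-comm (σ i) M ⟩
      M * σ i                                    ∎)
      where
      m = suc (r ℕ.+ r)
      M = + m
      a = + suc i
      open ModReasoning (+ 2 * M)
      sign : σ (suc (suc (m ℕ.+ i))) ≡ - 1ℤ * σ i
      sign = trans (σ-2+ (m ℕ.+ i)) (trans (σ-+ m i) (cong (_* σ i) (σ-odd r)))
      lemma : ∀ s x y → s * x + - 1ℤ * s * y ≡ s * (x - y)
      lemma = solve-∀

    half-odd-m : ∀ r → HalfCongruence (suc (r ℕ.+ r))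
    half-odd-m r = begin
      Σ< (term e) (m ℕ.+ m)                              ≡⟨ Σ<-halves m ⟩
      Σ< (term e) m + Σ< (λ i → term e (m ℕ.+ i)) m      ≡⟨ Σ<-+ (term e) (λ i → term e (m ℕ.+ i)) m ⟨
      Σ< (λ i → term e i + term e (m ℕ.+ i)) m           ≈⟨ Σ<-mod _ _ m (λ i _ → odd-pair r i) ⟩
      Σ< (λ i → + m * σ i) m                             ≡⟨ Σ<-*ˡ (+ m) σ m ⟩
      + m * Σ< σ m                                       ≡⟨ cong (+ m *_) (Σ<σ-odd r) ⟩
      + m * 1ℤ                                           ≡⟨ *-identityʳ (+ m) ⟩
      + m                                                ∎
      where
      m = suc (r ℕ.+ r)
      open ModReasoning (+ (m ℕ.+ m))

    -- For even m = 2r, shifting the index by m fixes a summand modulo 2m: the sign is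
    -- unchanged, and (a + m)^e ≡ a^e + e m a^(e-1) modulo m² = r (2m), where 2m ∣ e m.
    even-shift : ∀ r i → let m = r ℕ.+ r in term e (m ℕ.+ i) ≡ term e i [mod + (m ℕ.+ m) ]
    even-shift r i = mod-* (≡⇒mod sign) power
      where
      m = r ℕ.+ r
      a = + suc i
      x = a ^ (t ℕ.+ suc t)
      sign : σ (suc (suc (m ℕ.+ i))) ≡ σ (suc (suc i))
      sign = begin
        σ (suc (suc (m ℕ.+ i)))  ≡⟨ σ-2+ (m ℕ.+ i) ⟩
        σ (m ℕ.+ i)              ≡⟨ σ-+ m i ⟩
        σ m * σ i                ≡⟨ cong (_* σ i) (σ-even r) ⟩
        1ℤ * σ i                 ≡⟨ *-identityˡ (σ i) ⟩
        σ i                      ≡⟨ σ-2+ i ⟨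
        σ (suc (suc i))          ∎
        where open ≡-Reasoning
      square : + m * + m ≡ + r * + (m ℕ.+ m)
      square = begin
        + m * + m                     ≡⟨ cong₂ _*_ (pos-double r) (pos-double r) ⟩
        (+ 2 * + r) * (+ 2 * + r)     ≡⟨ lemma (+ r) ⟩
        + r * (+ 2 * (+ 2 * + r))     ≡⟨ cong (λ V → + r * (+ 2 * V)) (pos-double r) ⟨
        + r * (+ 2 * + m)             ≡⟨ cong (+ r *_) (pos-double m) ⟨
        + r * + (m ℕ.+ m)             ∎
        where
        open ≡-Reasoning
        lemma : ∀ r → (+ 2 * r) * (+ 2 * r) ≡ r * (+ 2 * (+ 2 * r))
        lemma = solve-∀
      first-order : (+ e) * + m * x ≡ (+ suc t * x) * + (m ℕ.+ m)
      first-order = begin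
        (+ e) * + m * x                 ≡⟨ cong (λ E → E * + m * x) (pos-double (suc t)) ⟩
        (+ 2 * + suc t) * + m * x       ≡⟨ lemma (+ suc t) (+ m) x ⟩
        (+ suc t * x) * (+ 2 * + m)     ≡⟨ cong (+ suc t * x *_) (pos-double m) ⟨
        (+ suc t * x) * + (m ℕ.+ m)     ∎
        where
        open ≡-Reasoning
        lemma : ∀ u m x → (+ 2 * u) * m * x ≡ u * x * (+ 2 * m)
        lemma = solve-∀
      power : (+ suc (m ℕ.+ i)) ^ e ≡ a ^ e [mod + (m ℕ.+ m) ]
      power = begin
        (+ suc (m ℕ.+ i)) ^ e                 ≡⟨ cong (_^ e) (shifted-base m i) ⟩
        (a + + m) ^ e
          ≈⟨ mod-weaken (+ r) (mod-modulus square (binomial a (+ m) (t ℕ.+ suc t))) ⟩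
        a ^ e + (+ e) * + m * x               ≡⟨ cong (λ y → a ^ e + y) first-order ⟩
        a ^ e + (+ suc t * x) * + (m ℕ.+ m)   ≈⟨ mod-+ (mod-refl {a = a ^ e}) (multiple≡0 (+ suc t * x)) ⟩
        a ^ e + 0ℤ                            ≡⟨ +-identityʳ (a ^ e) ⟩
        a ^ e                                 ∎
        where open ModReasoning (+ (m ℕ.+ m))

    half-double : ∀ r → HalfCongruence r → HalfCongruence (r ℕ.+ r)
    half-double r half-r = begin
      Σ< (term e) (m ℕ.+ m)                           ≡⟨ Σ<-halves m ⟩
      Σ< (term e) m + Σ< (λ i → term e (m ℕ.+ i)) m
        ≈⟨ mod-+ (mod-refl {a = Σ< (term e) m}) (Σ<-mod _ _ m (λ i _ → even-shift r i)) ⟩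
      Σ< (term e) m + Σ< (term e) m                   ≡⟨ double (Σ< (term e) m) ⟩
      + 2 * Σ< (term e) m                             ≈⟨ mod-modulus (sym (pos-double m)) (mod-scale (+ 2) half-r) ⟩
      + 2 * + r                                       ≡⟨ pos-double r ⟨
      + m                                             ∎
      where
      m = r ℕ.+ r
      open ModReasoning (+ (m ℕ.+ m))
      double : ∀ x → x + x ≡ + 2 * x
      double = solve-∀

    half-congruence : ∀ m → HalfCongruence m
    half-congruence = <-rec HalfCongruence step
      where
      step : ∀ m → (∀ {k} → k < m → HalfCongruence k) → HalfCongruence m
      step m ih with even-or-odd m
      ... | odd r        = half-odd-m r
      ... | even zero    = mod-refl
      ... | even (suc r) = half-double (suc r) (ih (s≤s (ℕ.m≤n+m (suc r) r)))

  altSum-half-modulus : ∀ t m → altSum (suc t ℕ.+ suc t) (m ℕ.+ m) ≡ + m [mod + (m ℕ.+ m) ]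
  altSum-half-modulus t m =
    mod-trans (≡⇒mod (altSum-Σ< _ (m ℕ.+ m))) (HalfModulus.half-congruence t m)

  -- With N = 2m, X = Σ_{j≤N} (-1)^j j^k and Y = Σ_{j≤N} (-1)^j j^e, reflecting j ↦ N - j
  -- and expanding (N - j)^k to first order gives X ≡ -X + k N Y modulo N²; the half
  -- modulus gives Y ≡ -m modulo N, whence 2X ≡ -2m² modulo 4m².
  module SquareModulus (t m : ℕ) where

    e = suc t ℕ.+ suc t
    k = suc e
    N = m ℕ.+ m
    W = + N
    X = Σ< (signedPower k) (suc N)
    Y = Σ< (signedPower e) (suc N)

    reflected : ∀ j → j ≤ N →
                signedPower k (N ∸ j) ≡ - signedPower k j + + k * W * signedPower e j [mod W * W ]
    reflected j j≤N = begin
      σ (N ∸ j) * (+ (N ∸ j)) ^ k                      ≡⟨ cong₂ _*_ sign base ⟩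
      σ j * - y ^ k                                    ≈⟨ mod-* (mod-refl {a = σ j}) (mod-neg expansion) ⟩
      σ j * - ((+ j) ^ k + + k * - W * (+ j) ^ e)      ≡⟨ lemma₂ (σ j) ((+ j) ^ k) (+ k) W ((+ j) ^ e) ⟩
      - signedPower k j + + k * W * signedPower e j    ∎
      where
      open ModReasoning (W * W)
      y = + j + - W
      sign : σ (N ∸ j) ≡ σ j
      sign = trans (σ-∸ j≤N) (trans (cong (_* σ j) (σ-even m)) (*-identityˡ (σ j)))
      lemma₁ : ∀ W j → W - j ≡ - (j + - W)
      lemma₁ = solve-∀
      base : (+ (N ∸ j)) ^ k ≡ - y ^ k
      base = trans (cong (_^ k) (trans (pos-∸ j≤N) (lemma₁ W (+ j)))) (neg-^-odd y (suc t))
      expansion : y ^ k ≡ (+ j) ^ k + + k * - W * (+ j) ^ e [mod W * W ]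
      expansion = mod-modulus (neg-square W) (binomial (+ j) (- W) e)
        where
        neg-square : ∀ W → - W * - W ≡ W * W
        neg-square = solve-∀
      lemma₂ : ∀ s a K W b → s * - (a + K * - W * b) ≡ - (s * a) + K * W * (s * b)
      lemma₂ = solve-∀

    X-reflected : X ≡ - X + + k * W * Y [mod W * W ]
    X-reflected = mod-trans (Σ<-reflect (signedPower k) _ N reflected) (≡⇒mod (begin
      Σ< (λ j → - signedPower k j + + k * W * signedPower e j) (suc N)
        ≡⟨ Σ<-+ _ _ (suc N) ⟩
      Σ< (λ j → - signedPower k j) (suc N) + Σ< (λ j → + k * W * signedPower e j) (suc N)
        ≡⟨ cong₂ _+_ (Σ<-neg (signedPower k) (suc N)) (Σ<-*ˡ (+ k * W) (signedPower e) (suc N)) ⟩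
      - X + + k * W * Y
        ∎))
      where open ≡-Reasoning

    Y≡-m : Y ≡ - + m [mod W ]
    Y≡-m = mod-trans (≡⇒mod (Σ<-signedPower (t ℕ.+ suc t) N)) (mod-neg (altSum-half-modulus t m))

    main-term : + k * W * - + m ≡ + 2 * - (+ m * + m) + - + suc t * (W * W)
    main-term = begin
      + k * W * - M
        ≡⟨ cong₂ (λ K V → K * V * - M) (pos-odd (suc t)) (pos-double m) ⟩
      (1ℤ + + 2 * U) * (+ 2 * M) * - M
        ≡⟨ polynomial U M ⟩
      + 2 * - (M * M) + - U * ((+ 2 * M) * (+ 2 * M))
        ≡⟨ cong (λ V → + 2 * - (M * M) + - U * (V * V)) (pos-double m) ⟨
      + 2 * - (M * M) + - U * (W * W)
        ∎
      where
      open ≡-Reasoning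
      U = + suc t
      M = + m
      polynomial : ∀ U M → (1ℤ + + 2 * U) * (+ 2 * M) * - M ≡
                   + 2 * - (M * M) + - U * ((+ 2 * M) * (+ 2 * M))
      polynomial = solve-∀

    twice-X : + 2 * X ≡ + 2 * - (+ m * + m) [mod W * W ]
    twice-X = begin
      + 2 * X                                     ≡⟨ double X ⟩
      X + X                                       ≈⟨ mod-+ X-reflected (mod-refl {a = X}) ⟩
      - X + + k * W * Y + X                       ≡⟨ cancel X (+ k * W * Y) ⟩
      + k * W * Y
        ≈⟨ mod-weaken (+ k) (mod-modulus (*-assoc (+ k) W W) (mod-scale (+ k * W) Y≡-m)) ⟩
      + k * W * - + m                             ≡⟨ main-term ⟩
      + 2 * - (+ m * + m) + - + suc t * (W * W)
        ≈⟨ mod-+ (mod-refl {a = + 2 * - (+ m * + m)}) (multiple≡0 (- + suc t)) ⟩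
      + 2 * - (+ m * + m) + 0ℤ                    ≡⟨ +-identityʳ _ ⟩
      + 2 * - (+ m * + m)                         ∎
      where
      open ModReasoning (W * W)
      double : ∀ x → + 2 * x ≡ x + x
      double = solve-∀
      cancel : ∀ x z → - x + z + x ≡ z
      cancel = solve-∀

    X≡-m² : X ≡ - (+ m * + m) [mod + 2 * (+ m * + m) ]
    X≡-m² = mod-cancel (+ 2) (mod-modulus modulus twice-X)
      where
      polynomial : ∀ M → (+ 2 * M) * (+ 2 * M) ≡ + 2 * (+ 2 * (M * M))
      polynomial = solve-∀
      modulus : W * W ≡ + 2 * (+ 2 * (+ m * + m))
      modulus = trans (cong₂ _*_ (pos-double m) (pos-double m)) (polynomial (+ m))

  altSum-square-modulus : ∀ t m →
    altSum (suc (suc t ℕ.+ suc t)) (m ℕ.+ m) ≡ + (m ℕ.* m) [mod + (2 ℕ.* (m ℕ.* m)) ]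
  altSum-square-modulus t m = mod-modulus (sym (pos-twice-square m)) (begin
    altSum k N            ≡⟨ altSum≡-Σ< e N ⟩
    - X                   ≈⟨ mod-neg X≡-m² ⟩
    - - (+ m * + m)       ≡⟨ neg-involutive (+ m * + m) ⟩
    + m * + m             ≡⟨ pos-* m m ⟨
    + (m ℕ.* m)           ∎)
    where
    open SquareModulus t m
    open ModReasoning (+ 2 * (+ m * + m))

  power-divisible : ∀ a j → + (a ℕ.^ suc j) ≡ 0ℤ [mod + a ]
  power-divisible a j = mod-trans (≡⇒mod factor) (multiple≡0 (+ (a ℕ.^ j)))
    where
    factor : + (a ℕ.^ suc j) ≡ + (a ℕ.^ j) * + a
    factor = trans (pos-* a (a ℕ.^ j)) (*-comm (+ a) (+ (a ℕ.^ j)))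

  double-power-divisible : ∀ m j → + ((m ℕ.+ m) ℕ.^ suc (suc j)) ≡ 0ℤ [mod + (2 ℕ.* (m ℕ.* m)) ]
  double-power-divisible m j = mod-trans (≡⇒mod factor) (multiple≡0 (+ 2 * + z))
    where
    b = m ℕ.+ m
    z = b ℕ.^ j
    polynomial : ∀ M Z → (+ 2 * M) * ((+ 2 * M) * Z) ≡ + 2 * Z * (+ 2 * (M * M))
    polynomial = solve-∀
    factor : + (b ℕ.^ suc (suc j)) ≡ + 2 * + z * + (2 ℕ.* (m ℕ.* m))
    factor = begin
      + (b ℕ.* (b ℕ.* z))                   ≡⟨ trans (pos-* b (b ℕ.* z)) (cong (+ b *_) (pos-* b z)) ⟩
      + b * (+ b * + z)                     ≡⟨ cong (λ B → B * (B * + z)) (pos-double m) ⟩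
      (+ 2 * + m) * ((+ 2 * + m) * + z)     ≡⟨ polynomial (+ m) (+ z) ⟩
      + 2 * + z * (+ 2 * (+ m * + m))       ≡⟨ cong (λ V → + 2 * + z * V) (pos-twice-square m) ⟨
      + 2 * + z * + (2 ℕ.* (m ℕ.* m))       ∎
      where open ≡-Reasoning

  -- k even, n = 2m + 1 odd: A k n ≡ 0 modulo n m, combining the odd modulus n (after
  -- dropping the last summand n^k) with the half modulus, as n and m are coprime.
  case-even-odd : ∀ t m → A (suc t ℕ.+ suc t) (suc (m ℕ.+ m)) ≡ 0ℤ [mod + (suc (m ℕ.+ m) ℕ.* m) ]
  case-even-odd t m = mod-*-zero (σ n) (mod-modulus (sym (pos-* n m)) T≡0)
    where
    n = suc (m ℕ.+ m)
    k = suc t ℕ.+ suc t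
    T = altSum k (m ℕ.+ m)
    T≡0-mod-n : T ≡ 0ℤ [mod + n ]
    T≡0-mod-n = mod-trans (altSum-init k (m ℕ.+ m) (power-divisible n (t ℕ.+ suc t)))
                          (altSum-odd-modulus t m)
    T≡0-mod-m : T ≡ 0ℤ [mod + m ]
    T≡0-mod-m = mod-trans (mod-weaken (+ 2) (mod-modulus (pos-double m) (altSum-half-modulus t m)))
                          (mod-trans (≡⇒mod (sym (*-identityˡ (+ m)))) (multiple≡0 1ℤ))
    bezout : 1ℤ * + n + - + 2 * + m ≡ 1ℤ
    bezout = trans (cong (λ d → 1ℤ * d + - + 2 * + m) (pos-odd m)) (lemma (+ m))
      where
      lemma : ∀ m → 1ℤ * (1ℤ + + 2 * m) + - + 2 * m ≡ 1ℤ
      lemma = solve-∀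
    T≡0 : T ≡ 0ℤ [mod + n * + m ]
    T≡0 = mod-crt 1ℤ (- + 2) bezout T≡0-mod-n T≡0-mod-m

  case-even-even : ∀ t r → A (suc t ℕ.+ suc t) (suc r ℕ.+ suc r) ≡ 0ℤ [mod + (r ℕ.+ suc r) ]
  case-even-even t r = at-odd (r ℕ.+ suc r) (ℕ.+-suc r r)
    where
    at-odd : ∀ d → d ≡ suc (r ℕ.+ r) → σ (suc d) * altSum (suc t ℕ.+ suc t) d ≡ 0ℤ [mod + d ]
    at-odd _ refl = mod-*-zero (σ (suc (suc (r ℕ.+ r)))) (altSum-odd-modulus t r)

  case-odd-even : ∀ t m → let m' = suc m in
    A (suc (suc t ℕ.+ suc t)) (m' ℕ.+ m') ≡ + (m' ℕ.* m') [mod + (2 ℕ.* (m' ℕ.* m')) ]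
  case-odd-even t m = begin
    σ (m' ℕ.+ m') * altSum k j   ≡⟨ cong (_* altSum k j) (σ-even m') ⟩
    1ℤ * altSum k j              ≡⟨ *-identityˡ (altSum k j) ⟩
    altSum k j                   ≈⟨ altSum-init k j (double-power-divisible m' (t ℕ.+ suc t)) ⟩
    altSum k (m' ℕ.+ m')         ≈⟨ altSum-square-modulus t m' ⟩
    + (m' ℕ.* m')                ∎
    where
    m' = suc m
    k = suc (suc t ℕ.+ suc t)
    j = m ℕ.+ m'
    open ModReasoning (+ (2 ℕ.* (m' ℕ.* m')))

  case-odd-odd : ∀ t m →
    A (suc (suc t ℕ.+ suc t)) (suc (m ℕ.+ m)) ≡ + (m ℕ.* m) [mod + (2 ℕ.* (m ℕ.* m)) ]
  case-odd-odd t m = begin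
    σ (suc (m ℕ.+ m)) * altSum k (m ℕ.+ m)   ≡⟨ cong (_* altSum k (m ℕ.+ m)) (σ-odd m) ⟩
    - 1ℤ * altSum k (m ℕ.+ m)                ≡⟨ -1*i≡-i (altSum k (m ℕ.+ m)) ⟩
    - altSum k (m ℕ.+ m)                     ≈⟨ mod-neg (altSum-square-modulus t m) ⟩
    - + m²                                   ≈⟨ mod-by (- 1ℤ) negate ⟩
    + m²                                     ∎
    where
    k = suc (suc t ℕ.+ suc t)
    m² = m ℕ.* m
    open ModReasoning (+ (2 ℕ.* m²))
    lemma : ∀ x → - x ≡ x + - 1ℤ * (+ 2 * x)
    lemma = solve-∀
    negate : - + m² ≡ + m² + - 1ℤ * + (2 ℕ.* m²)
    negate = trans (lemma (+ m²)) (cong (λ V → + m² + - 1ℤ * V) (sym (pos-* 2 m²)))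

  even-k-odd-n : ∀ k n → 1 < k → Even k → Odd n → A k n ≡ + 0 [modℤ (n ℕ.* (n ∸ 1)) / 2 ]
  even-k-odd-n k n 1<k k-even n-odd with even-or-odd k | even-or-odd n
  ... | odd r        | _      = ⊥-elim (odd-not-even r k-even)
  even-k-odd-n _ _ () _ _ | even zero | _
  ... | even (suc t) | even r = ⊥-elim (n-odd (even-double r))
  ... | even (suc t) | odd m  rewrite triangular-odd m = mod⇒modℤ (case-even-odd t m)

  even-k-even-n : ∀ k n → 1 < k → Even k → Even n → A k n ≡ + 0 [modℤ n ∸ 1 ]
  even-k-even-n k n 1<k k-even n-even with even-or-odd k | even-or-odd n
  ... | odd r        | _            = ⊥-elim (odd-not-even r k-even)
  even-k-even-n _ _ () _ _ | even zero | _
  ... | even (suc t) | odd m        = ⊥-elim (odd-not-even m n-even)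
  ... | even (suc t) | even zero    = mod⇒modℤ (mod-refl {a = 0ℤ})
  ... | even (suc t) | even (suc r) = mod⇒modℤ (case-even-even t r)

  odd-k : ∀ k n → 1 < k → Odd k →
          A k n ≡ + ((n / 2) ℕ.* (n / 2)) [modℤ 2 ℕ.* ((n / 2) ℕ.* (n / 2)) ]
  odd-k k n 1<k k-odd with even-or-odd k | even-or-odd n
  ... | even r      | _            = ⊥-elim (k-odd (even-double r))
  odd-k _ _ (s≤s ()) _ | odd zero | _
  ... | odd (suc t) | even zero    = mod⇒modℤ (mod-refl {a = 0ℤ})
  ... | odd (suc t) | even (suc m) rewrite half-even (suc m) = mod⇒modℤ (case-odd-even t m)
  ... | odd (suc t) | odd m        rewrite half-odd m        = mod⇒modℤ (case-odd-odd t m)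

open import Data.Nat using (ℕ; _<_; _∸_; _*_; _/_)
open import Data.Integer using (+_)
open import Data.Product using (_×_; _,_)
open AlternatingSums using (even-k-odd-n; even-k-even-n; odd-k)

lemma2 : (k n : ℕ) → 1 < k → 1 < n →
    ((Even k → Odd n → A k n ≡ + 0 [modℤ (n * (n ∸ 1)) / 2 ])
    × (Even k → Even n → A k n ≡ + 0 [modℤ n ∸ 1 ])
    × (Odd k → A k n ≡ + ((n / 2) * (n / 2)) [modℤ 2 * ((n / 2) * (n / 2)) ]))
lemma2 k n 1<k _ = even-k-odd-n k n 1<k , even-k-even-n k n 1<k , odd-k k n 1<k
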